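{- Let $m\ge1$, $r\in\mathbb{N}$, $n_1,\ldots,n_m\in\mathbb{N}$, $\tau_1,\ldots,\tau_m\in\mathbb{N}_0$, $N=\sum_{j=1}^mn_j$, and \[ A_k=(-1)^{k+N}\binom{N}{k}\binom{rk+n_1+\tau_1}{n_1}\cdots\binom{rk+n_m+\tau_m}{n_m},\qquad k=0,\ldots,N . \] Then $\sum_{k=0}^NA_k=\dfrac{N!\,r^N}{n_1!\cdots n_m!}$. -}

module Defs where

open import Data.Nat using (ℕ; zero; suc; _+_; _*_; _^_; NonZero)
open import Data.Nat.Properties using (_!≢0; m*n≢0)
open import Data.Nat.Combinatorics using (_C_)
open import Data.Nat.Base using (_!)
open import Data.Fin using (Fin; zero; suc)
open import Data.Integer as ℤ using (ℤ; +_)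

sumℕ : ∀ m → (Fin m → ℕ) → ℕ
sumℕ zero    f = 0
sumℕ (suc m) f = f zero + sumℕ m (λ j → f (suc j))

prodℕ : ∀ m → (Fin m → ℕ) → ℕ
prodℕ zero    f = 1
prodℕ (suc m) f = f zero * prodℕ m (λ j → f (suc j))

sumTo : ℕ → (ℕ → ℤ) → ℤ
sumTo zero    g = g 0
sumTo (suc N) g = sumTo N g ℤ.+ g (suc N)

sign : ℕ → ℤ
sign zero          = + 1
sign (suc zero)    = ℤ.- (+ 1)
sign (suc (suc e)) = sign e

prodFact≢0 : ∀ m (n : Fin m → ℕ) → NonZero (prodℕ m (λ j → n j !))
prodFact≢0 zero    n = _
prodFact≢0 (suc m) n = m*n≢0 (n zero !) _ {{n zero !≢0}} {{prodFact≢0 m (λ j → n (suc j))}}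

A : ∀ m (r : ℕ) (n τ : Fin m → ℕ) → ℕ → ℤ
A m r n τ k = sign (k + sumℕ m n) ℤ.*
  (+ ((sumℕ m n C k) * prodℕ m (λ j → (r * k + n j + τ j) C n j)))

module Submission where

-- The alternating sum Σ_k (-1)^{k+N} C(N,k) f(k) is the N-th forward difference
-- Δ^N f(0) (Newton's formula).  Here f(k) = Π_j C(r k + n_j + τ_j, n_j) is a
-- product of m polynomial sequences in k of degrees n_1, …, n_m, so the theorem
-- amounts to computing the constant N-th difference of such a product.

module Differences where

  open import Defs using (sumTo; sign)
  open import Data.Nat as ℕ using (ℕ; zero; suc)
  open import Data.Integer using (ℤ; +_; _+_; _*_; _-_; -_)
  open import Data.Nat.Properties using (+-suc; +-identityʳ; n<1+n)
  open import Data.Nat.Combinatorics using (_C_; nCk+nC[k+1]≡[n+1]C[k+1]; nCn≡1; k>n⇒nCk≡0)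
  open import Data.Integer.Properties using (pos-+)
  open import Data.Integer.Solver using (module +-*-Solver)
  open +-*-Solver
  open import Relation.Binary.PropositionalEquality

  Seq : Set
  Seq = ℕ → ℤ

  Δ : Seq → Seq
  Δ f k = f (suc k) - f k

  Δ^ : ℕ → Seq → Seq
  Δ^ zero    f = f
  Δ^ (suc n) f = Δ^ n (Δ f)

  Δ^-suc : ∀ n f k → Δ^ (suc n) f k ≡ Δ^ n f (suc k) - Δ^ n f k
  Δ^-suc zero    f k = refl
  Δ^-suc (suc n) f k = Δ^-suc n (Δ f) k

  Δ^-cong : ∀ n {f g} → f ≗ g → Δ^ n f ≗ Δ^ n g
  Δ^-cong zero    f≗g = f≗g
  Δ^-cong (suc n) f≗g = Δ^-cong n (λ k → cong₂ _-_ (f≗g (suc k)) (f≗g k))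

  Δ^-+ : ∀ n f g → Δ^ n (λ k → f k + g k) ≗ λ k → Δ^ n f k + Δ^ n g k
  Δ^-+ zero    f g k = refl
  Δ^-+ (suc n) f g k = trans (Δ^-cong n regroup k) (Δ^-+ n (Δ f) (Δ g) k)
    where
    regroup : Δ (λ i → f i + g i) ≗ λ i → Δ f i + Δ g i
    regroup i = solve 4 (λ a b c d → (a :+ b) :- (c :+ d) := (a :- c) :+ (b :- d))
                  refl (f (suc i)) (g (suc i)) (f i) (g i)

  Δ^-scale : ∀ n c f → Δ^ n (λ k → c * f k) ≗ λ k → c * Δ^ n f k
  Δ^-scale zero    c f k = refl
  Δ^-scale (suc n) c f k = trans (Δ^-cong n factor k) (Δ^-scale n c (Δ f) k)
    where
    factor : Δ (λ i → c * f i) ≗ λ i → c * Δ f i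
    factor i = solve 3 (λ c a b → c :* a :- c :* b := c :* (a :- b)) refl c (f (suc i)) (f i)

  Δ^-shift : ∀ n f → Δ^ n (λ k → f (suc k)) ≗ λ k → Δ^ n f (suc k)
  Δ^-shift zero    f k = refl
  Δ^-shift (suc n) f k = Δ^-shift n (Δ f) k

  Δ-product : ∀ f g k → Δ (λ i → f i * g i) k ≡ Δ f k * g (suc k) + f k * Δ g k
  Δ-product f g k = solve 4 (λ a b x y → a :* y :- b :* x := (a :- b) :* y :+ b :* (y :- x))
                      refl (f (suc k)) (f k) (g k) (g (suc k))

  Σ< : ℕ → Seq → ℤ
  Σ< zero    g = + 0
  Σ< (suc M) g = g 0 + Σ< M (λ k → g (suc k))

  Σ<-cong : ∀ M {g h} → g ≗ h → Σ< M g ≡ Σ< M h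
  Σ<-cong zero    g≗h = refl
  Σ<-cong (suc M) g≗h = cong₂ _+_ (g≗h 0) (Σ<-cong M (λ k → g≗h (suc k)))

  Σ<-- : ∀ M g h → Σ< M (λ k → g k - h k) ≡ Σ< M g - Σ< M h
  Σ<-- zero    g h = refl
  Σ<-- (suc M) g h = trans (cong (_+_ (g 0 - h 0)) (Σ<-- M _ _))
    (solve 4 (λ a b c d → (a :- b) :+ (c :- d) := (a :+ c) :- (b :+ d)) refl (g 0) (h 0) (Σ< M _) (Σ< M _))

  Σ<-snoc : ∀ M g → Σ< (suc M) g ≡ Σ< M g + g M
  Σ<-snoc zero    g = solve 1 (λ a → a :+ con (+ 0) := con (+ 0) :+ a) refl (g 0)
  Σ<-snoc (suc M) g = trans (cong (_+_ (g 0)) (Σ<-snoc M _))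
    (solve 3 (λ a b c → a :+ (b :+ c) := (a :+ b) :+ c) refl (g 0) (Σ< M _) (g (suc M)))

  Σ<-const : ∀ M c → Σ< M (λ _ → c) ≡ + M * c
  Σ<-const zero    c = solve 1 (λ c → con (+ 0) := con (+ 0) :* c) refl c
  Σ<-const (suc M) c rewrite Σ<-const M c | pos-+ 1 M =
    solve 2 (λ c r → c :+ r :* c := (con (+ 1) :+ r) :* c) refl c (+ M)

  sumTo≡Σ< : ∀ N g → sumTo N g ≡ Σ< (suc N) g
  sumTo≡Σ< zero    g = solve 1 (λ a → a := a :+ con (+ 0)) refl (g 0)
  sumTo≡Σ< (suc N) g = trans (cong (_+ g (suc N)) (sumTo≡Σ< N g)) (sym (Σ<-snoc (suc N) g))

  sign-suc : ∀ e → sign (suc e) ≡ - sign e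
  sign-suc zero          = refl
  sign-suc (suc zero)    = refl
  sign-suc (suc (suc e)) = sign-suc e

  -- The k-th term of the N-th alternating sum of f at j is
  -- (-1)^{k+N} C(N,k) f(j+k); the partial sum over k < M is considered for
  -- every M so that Pascal's rule can be applied termwise.
  newtonTerm : ℕ → Seq → ℕ → Seq
  newtonTerm N f j k = sign (k ℕ.+ N) * (+ (N C k) * f (j ℕ.+ k))

  newtonSum : ℕ → ℕ → Seq → ℕ → ℤ
  newtonSum M N f j = Σ< M (newtonTerm N f j)

  newtonTerm-zero : ∀ N f j → newtonTerm (suc N) f j 0 ≡ - newtonTerm N f j 0
  newtonTerm-zero N f j rewrite sign-suc N =
    solve 2 (λ s x → (:- s) :* x := :- (s :* x)) refl (sign N) (+ 1 * f (j ℕ.+ 0))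

  newtonTerm-suc : ∀ N f j k →
    newtonTerm (suc N) f j (suc k) ≡ newtonTerm N f (suc j) k - newtonTerm N f j (suc k)
  newtonTerm-suc N f j k
    rewrite +-suc k N | sign-suc (k ℕ.+ N) | sym (nCk+nC[k+1]≡[n+1]C[k+1] N k)
          | pos-+ (N C k) (N C suc k) | +-suc j k =
    solve 4 (λ s a b x → s :* ((a :+ b) :* x) := s :* (a :* x) :- (:- s) :* (b :* x))
      refl (sign (k ℕ.+ N)) (+ (N C k)) (+ (N C suc k)) (f (suc (j ℕ.+ k)))

  newtonSum-suc : ∀ M N f j →
    newtonSum (suc M) (suc N) f j ≡ newtonSum M N f (suc j) - newtonSum (suc M) N f j
  newtonSum-suc M N f j = begin
      newtonTerm (suc N) f j 0 + Σ< M (λ k → newtonTerm (suc N) f j (suc k))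
    ≡⟨ cong₂ _+_ (newtonTerm-zero N f j) (Σ<-cong M (newtonTerm-suc N f j)) ⟩
      - t₀ + Σ< M (λ k → newtonTerm N f (suc j) k - newtonTerm N f j (suc k))
    ≡⟨ cong (_+_ (- t₀)) (Σ<-- M _ _) ⟩
      - t₀ + (newtonSum M N f (suc j) - rest)
    ≡⟨ solve 3 (λ a b c → :- a :+ (b :- c) := b :- (a :+ c)) refl t₀ (newtonSum M N f (suc j)) rest ⟩
      newtonSum M N f (suc j) - newtonSum (suc M) N f j
    ∎
    where
    open ≡-Reasoning
    t₀   = newtonTerm N f j 0
    rest = Σ< M (λ k → newtonTerm N f j (suc k))

  -- Terms with k > N vanish, since C(N,k) = 0.
  newtonSum-tail : ∀ N f j → newtonSum (suc (suc N)) N f j ≡ newtonSum (suc N) N f j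
  newtonSum-tail N f j rewrite Σ<-snoc (suc N) (newtonTerm N f j) | k>n⇒nCk≡0 (n<1+n N) =
    solve 2 (λ a s → a :+ s :* con (+ 0) := a) refl (newtonSum (suc N) N f j) (sign (suc N ℕ.+ N))

  newton : ∀ N f j → newtonSum (suc N) N f j ≡ Δ^ N f j
  newton zero    f j rewrite +-identityʳ j =
    solve 1 (λ x → con (+ 1) :* (con (+ 1) :* x) :+ con (+ 0) := x) refl (f j)
  newton (suc N) f j = begin
      newtonSum (suc (suc N)) (suc N) f j
    ≡⟨ newtonSum-suc (suc N) N f j ⟩
      newtonSum (suc N) N f (suc j) - newtonSum (suc (suc N)) N f j
    ≡⟨ cong (_-_ (newtonSum (suc N) N f (suc j))) (newtonSum-tail N f j) ⟩
      newtonSum (suc N) N f (suc j) - newtonSum (suc N) N f j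
    ≡⟨ cong₂ _-_ (newton N f (suc j)) (newton N f j) ⟩
      Δ^ N f (suc j) - Δ^ N f j
    ≡⟨ sym (Δ^-suc N f j) ⟩
      Δ^ (suc N) f j
    ∎
    where open ≡-Reasoning

  -- Sequences whose n-th difference is the constant c: polynomials of degree
  -- at most n with leading coefficient c / n!.
  ConstΔ : ℕ → ℤ → Seq → Set
  ConstΔ n c f = ∀ k → Δ^ n f k ≡ c

  ConstΔ-cong : ∀ n {c f g} → f ≗ g → ConstΔ n c f → ConstΔ n c g
  ConstΔ-cong n f≗g hf k = trans (sym (Δ^-cong n f≗g k)) (hf k)

  ConstΔ-value : ∀ n {c d f} → c ≡ d → ConstΔ n c f → ConstΔ n d f
  ConstΔ-value n c≡d hf k = trans (hf k) c≡d

  ConstΔ-+ : ∀ n {c d f g} → ConstΔ n c f → ConstΔ n d g → ConstΔ n (c + d) (λ k → f k + g k)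
  ConstΔ-+ n {f = f} {g} hf hg k = trans (Δ^-+ n f g k) (cong₂ _+_ (hf k) (hg k))

  ConstΔ-scale : ∀ n {c f} e → ConstΔ n c f → ConstΔ n (e * c) (λ k → e * f k)
  ConstΔ-scale n {f = f} e hf k = trans (Δ^-scale n e f k) (cong (e *_) (hf k))

  ConstΔ-shift : ∀ n {c f} → ConstΔ n c f → ConstΔ n c (λ k → f (suc k))
  ConstΔ-shift n {f = f} hf k = trans (Δ^-shift n f k) (hf (suc k))

  ConstΔ-zero : ∀ n → ConstΔ n (+ 0) (λ _ → + 0)
  ConstΔ-zero zero    k = refl
  ConstΔ-zero (suc n) k = ConstΔ-zero n k

  ConstΔ-Σ : ∀ n M c (F : ℕ → Seq) → (∀ i → ConstΔ n c (F i)) →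
    ConstΔ n (Σ< M (λ _ → c)) (λ k → Σ< M (λ i → F i k))
  ConstΔ-Σ n zero    c F hF = ConstΔ-zero n
  ConstΔ-Σ n (suc M) c F hF = ConstΔ-+ n (hF 0) (ConstΔ-Σ n M c (λ i → F (suc i)) (λ i → hF (suc i)))

  -- Induction on a and b, using
  -- the discrete product rule and Pascal's rule; when a or b is 0 one factor
  -- is constant and the rule reduces to scaling.
  ConstΔ-* : ∀ a b {c d f g} → ConstΔ a c f → ConstΔ b d g →
    ConstΔ (a ℕ.+ b) (+ ((a ℕ.+ b) C a) * c * d) (λ k → f k * g k)
  ConstΔ-* zero b {c} {d} {f} {g} hf hg =
    ConstΔ-cong b {f = λ k → c * g k} (λ k → cong (_* g k) (sym (hf k)))
      (ConstΔ-value b unit-coefficient (ConstΔ-scale b {f = g} c hg))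
    where
    unit-coefficient : c * d ≡ + 1 * c * d
    unit-coefficient = solve 2 (λ c d → c :* d := con (+ 1) :* c :* d) refl c d
  ConstΔ-* (suc a) zero {c} {d} {f} {g} hf hg rewrite +-identityʳ a | nCn≡1 (suc a) =
    ConstΔ-cong (suc a) {f = λ k → d * f k} constant-factor
      (ConstΔ-value (suc a) {f = λ k → d * f k} unit-coefficient (ConstΔ-scale (suc a) {f = f} d hf))
    where
    constant-factor : ∀ k → d * f k ≡ f k * g k
    constant-factor k = trans (cong (_* f k) (sym (hg k))) (solve 2 (λ x y → x :* y := y :* x) refl (g k) (f k))
    unit-coefficient : d * c ≡ + 1 * c * d
    unit-coefficient = solve 2 (λ c d → d :* c := con (+ 1) :* c :* d) refl c d
  ConstΔ-* (suc a) (suc b) {c} {d} {f} {g} hf hg k = begin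
      Δ^ n (Δ (λ i → f i * g i)) k
    ≡⟨ Δ^-cong n (Δ-product f g) k ⟩
      Δ^ n (λ i → Δ f i * g (suc i) + f i * Δ g i) k
    ≡⟨ ConstΔ-+ n left right k ⟩
      + (n C a) * c * d + + (n C suc a) * c * d
    ≡⟨ solve 4 (λ x y c d → x :* c :* d :+ y :* c :* d := (x :+ y) :* c :* d) refl (+ (n C a)) (+ (n C suc a)) c d ⟩
      (+ (n C a) + + (n C suc a)) * c * d
    ≡⟨ cong (λ x → x * c * d) (trans (sym (pos-+ (n C a) (n C suc a))) (cong +_ (nCk+nC[k+1]≡[n+1]C[k+1] n a))) ⟩
      + (suc n C suc a) * c * d
    ∎
    where
    open ≡-Reasoning
    n = a ℕ.+ suc b
    left : ConstΔ n (+ (n C a) * c * d) (λ i → Δ f i * g (suc i))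
    left = ConstΔ-* a (suc b) {f = Δ f} {g = λ i → g (suc i)} hf (ConstΔ-shift (suc b) {f = g} hg)
    right : ConstΔ n (+ (n C suc a) * c * d) (λ i → f i * Δ g i)
    right = subst (λ x → ConstΔ x (+ (x C suc a) * c * d) (λ i → f i * Δ g i))
              (sym (+-suc a b)) (ConstΔ-* (suc a) b {f = f} {g = Δ g} hf hg)

module Binomials where

  open Differences
  open import Data.Nat as ℕ using (ℕ; zero; suc)
  open import Data.Nat.Properties using (+-suc; +-identityʳ; +-assoc; +-comm; *-suc)
  open import Data.Nat.Combinatorics using (_C_; nCk+nC[k+1]≡[n+1]C[k+1])
  open import Data.Integer using (+_; _+_; _-_)
  open import Data.Integer.Properties using (pos-+; pos-*)
  open import Data.Integer.Solver using (module +-*-Solver)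
  open +-*-Solver
  open import Relation.Binary.PropositionalEquality

  hockey-stick : ∀ n y R → + ((y ℕ.+ R) C suc n) - + (y C suc n) ≡ Σ< R (λ i → + ((y ℕ.+ i) C n))
  hockey-stick n y zero rewrite +-identityʳ y = solve 1 (λ a → a :- a := con (+ 0)) refl (+ (y C suc n))
  hockey-stick n y (suc R) = begin
      + ((y ℕ.+ suc R) C suc n) - + (y C suc n)
    ≡⟨ cong (λ z → + (z C suc n) - + (y C suc n)) (+-suc y R) ⟩
      + (suc (y ℕ.+ R) C suc n) - + (y C suc n)
    ≡⟨ cong (λ z → + z - + (y C suc n)) (sym (nCk+nC[k+1]≡[n+1]C[k+1] (y ℕ.+ R) n)) ⟩
      + ((y ℕ.+ R) C n ℕ.+ (y ℕ.+ R) C suc n) - + (y C suc n)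
    ≡⟨ cong (_- + (y C suc n)) (pos-+ ((y ℕ.+ R) C n) ((y ℕ.+ R) C suc n)) ⟩
      (+ ((y ℕ.+ R) C n) + + ((y ℕ.+ R) C suc n)) - + (y C suc n)
    ≡⟨ solve 3 (λ a b c → (a :+ b) :- c := (b :- c) :+ a) refl (+ ((y ℕ.+ R) C n)) (+ ((y ℕ.+ R) C suc n)) (+ (y C suc n)) ⟩
      (+ ((y ℕ.+ R) C suc n) - + (y C suc n)) + + ((y ℕ.+ R) C n)
    ≡⟨ cong (_+ + ((y ℕ.+ R) C n)) (hockey-stick n y R) ⟩
      Σ< R (λ i → + ((y ℕ.+ i) C n)) + + ((y ℕ.+ R) C n)
    ≡⟨ sym (Σ<-snoc R (λ i → + ((y ℕ.+ i) C n))) ⟩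
      Σ< (suc R) (λ i → + ((y ℕ.+ i) C n))
    ∎
    where open ≡-Reasoning

  binomialSeq : ℕ → ℕ → ℕ → Seq
  binomialSeq r n x k = + ((r ℕ.* k ℕ.+ x) C n)

  Δ-binomialSeq : ∀ r n x k → Δ (binomialSeq r (suc n) x) k ≡ Σ< r (λ i → binomialSeq r n (x ℕ.+ i) k)
  Δ-binomialSeq r n x k = begin
      + ((r ℕ.* suc k ℕ.+ x) C suc n) - + ((r ℕ.* k ℕ.+ x) C suc n)
    ≡⟨ cong (λ z → + (z C suc n) - + ((r ℕ.* k ℕ.+ x) C suc n)) shift ⟩
      + ((r ℕ.* k ℕ.+ x ℕ.+ r) C suc n) - + ((r ℕ.* k ℕ.+ x) C suc n)
    ≡⟨ hockey-stick n (r ℕ.* k ℕ.+ x) r ⟩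
      Σ< r (λ i → + ((r ℕ.* k ℕ.+ x ℕ.+ i) C n))
    ≡⟨ Σ<-cong r (λ i → cong (λ z → + (z C n)) (+-assoc (r ℕ.* k) x i)) ⟩
      Σ< r (λ i → binomialSeq r n (x ℕ.+ i) k)
    ∎
    where
    open ≡-Reasoning
    shift : r ℕ.* suc k ℕ.+ x ≡ r ℕ.* k ℕ.+ x ℕ.+ r
    shift rewrite *-suc r k = trans (+-assoc r (r ℕ.* k) x) (+-comm r (r ℕ.* k ℕ.+ x))

  ConstΔ-binomialSeq : ∀ r n x → ConstΔ n (+ (r ℕ.^ n)) (binomialSeq r n x)
  ConstΔ-binomialSeq r zero    x k = refl
  ConstΔ-binomialSeq r (suc n) x =
    ConstΔ-value n (trans (Σ<-const r _) (sym (pos-* r (r ℕ.^ n))))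
      (ConstΔ-cong n (λ k → sym (Δ-binomialSeq r n x k))
        (ConstΔ-Σ n r _ _ (λ i → ConstΔ-binomialSeq r n (x ℕ.+ i))))

module Products where

  open import Defs using (sumℕ; prodℕ; prodFact≢0; A; sign)
  open Differences
  open Binomials
  open import Data.Nat as ℕ using (ℕ; zero; suc; _+_; _*_; _^_; _∸_; _/_; _!)
  open import Data.Nat.Properties using (+-assoc; m≤m+n; m+n∸m≡n; _!*_!≢0; ^-distribˡ-+-*)
  open import Data.Nat.Combinatorics using (_C_; nCk≡n!/k![n-k]!; k![n∸k]!∣n!)
  open import Data.Nat.DivMod using (m/n*n≡m; m*n/n≡m)
  open import Data.Nat.Solver using (module +-*-Solver)
  open +-*-Solver
  open import Data.Fin using (Fin; zero; suc)
  open import Data.Integer as ℤ using (+_)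
  open import Data.Integer.Properties using (pos-*)
  open import Relation.Binary.PropositionalEquality

  binomial-factorials : ∀ a b → ((a + b) C a) * (a ! * b !) ≡ (a + b) !
  binomial-factorials a b = begin
      ((a + b) C a) * (a ! * b !)
    ≡⟨ cong (λ x → ((a + b) C a) * (a ! * x !)) (sym (m+n∸m≡n a b)) ⟩
      ((a + b) C a) * (a ! * (a + b ∸ a) !)
    ≡⟨ cong (_* (a ! * (a + b ∸ a) !)) (nCk≡n!/k![n-k]! a≤a+b) ⟩
      ((a + b) ! / (a ! * (a + b ∸ a) !)) {{a !* (a + b ∸ a) !≢0}} * (a ! * (a + b ∸ a) !)
    ≡⟨ m/n*n≡m {{a !* (a + b ∸ a) !≢0}} (k![n∸k]!∣n! a≤a+b) ⟩
      (a + b) !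
    ∎
    where
    open ≡-Reasoning
    a≤a+b = m≤m+n a b

  -- The multinomial coefficient (n_1 + ⋯ + n_m)! / (n_1! ⋯ n_m!), built as a
  -- product of binomial coefficients C(n_j + n_{j+1} + ⋯ + n_m, n_j).
  multinomial : ∀ m → (Fin m → ℕ) → ℕ
  multinomial zero    n = 1
  multinomial (suc m) n = ((n zero + sumℕ m (λ j → n (suc j))) C n zero) * multinomial m (λ j → n (suc j))

  multinomial-factorials : ∀ m n → multinomial m n * prodℕ m (λ j → n j !) ≡ sumℕ m n !
  multinomial-factorials zero    n = refl
  multinomial-factorials (suc m) n = begin
      c * M * (a ! * Π)
    ≡⟨ solve 4 (λ c M x P → c :* M :* (x :* P) := c :* (x :* (M :* P))) refl c M (a !) Π ⟩
      c * (a ! * (M * Π))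
    ≡⟨ cong (λ z → c * (a ! * z)) (multinomial-factorials m (λ j → n (suc j))) ⟩
      c * (a ! * b !)
    ≡⟨ binomial-factorials a b ⟩
      (a + b) !
    ∎
    where
    open ≡-Reasoning
    a = n zero
    b = sumℕ m (λ j → n (suc j))
    c = (a + b) C a
    M = multinomial m (λ j → n (suc j))
    Π = prodℕ m (λ j → n (suc j) !)

  multinomial≡quotient : ∀ m n x →
    ((sumℕ m n ! * x) / prodℕ m (λ j → n j !)) {{prodFact≢0 m n}} ≡ multinomial m n * x
  multinomial≡quotient m n x = begin
      (sumℕ m n ! * x) / Π
    ≡⟨ cong (λ z → (z * x) / Π) (sym (multinomial-factorials m n)) ⟩
      (multinomial m n * Π * x) / Π
    ≡⟨ cong (_/ Π) (solve 3 (λ M P x → M :* P :* x := M :* x :* P) refl (multinomial m n) Π x) ⟩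
      (multinomial m n * x * Π) / Π
    ≡⟨ m*n/n≡m (multinomial m n * x) Π ⟩
      multinomial m n * x
    ∎
    where
    open ≡-Reasoning
    Π = prodℕ m (λ j → n j !)
    instance
      Π≢0 : ℕ.NonZero Π
      Π≢0 = prodFact≢0 m n

  productSeq : ∀ m (r : ℕ) (n τ : Fin m → ℕ) → Seq
  productSeq m r n τ k = + prodℕ m (λ j → (r * k + n j + τ j) C n j)

  A≡newtonTerm : ∀ m r n τ k → A m r n τ k ≡ newtonTerm (sumℕ m n) (productSeq m r n τ) 0 k
  A≡newtonTerm m r n τ k =
    cong (sign (k + sumℕ m n) ℤ.*_) (pos-* (sumℕ m n C k) (prodℕ m (λ j → (r * k + n j + τ j) C n j)))

  ConstΔ-productSeq : ∀ m r n τ →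
    ConstΔ (sumℕ m n) (+ (multinomial m n * r ^ sumℕ m n)) (productSeq m r n τ)
  ConstΔ-productSeq zero    r n τ k = refl
  ConstΔ-productSeq (suc m) r n τ =
    ConstΔ-cong (a + b) {f = split} split≗productSeq
      (ConstΔ-value (a + b) {f = split} leading
        (ConstΔ-* a b (ConstΔ-binomialSeq r a (a + τ zero)) (ConstΔ-productSeq m r n′ τ′)))
    where
    n′ = λ j → n (suc j)
    τ′ = λ j → τ (suc j)
    a = n zero
    b = sumℕ m n′
    c = (a + b) C a
    M = multinomial m n′
    split : Seq
    split k = binomialSeq r a (a + τ zero) k ℤ.* productSeq m r n′ τ′ k
    split≗productSeq : ∀ k → split k ≡ productSeq (suc m) r n τ k
    split≗productSeq k = begin
        + ((r * k + (a + τ zero)) C a) ℤ.* + rest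
      ≡⟨ sym (pos-* ((r * k + (a + τ zero)) C a) rest) ⟩
        + (((r * k + (a + τ zero)) C a) * rest)
      ≡⟨ cong (λ z → + ((z C a) * rest)) (sym (+-assoc (r * k) a (τ zero))) ⟩
        productSeq (suc m) r n τ k
      ∎
      where
      open ≡-Reasoning
      rest = prodℕ m (λ j → (r * k + n′ j + τ′ j) C n′ j)
    leading : + c ℤ.* + (r ^ a) ℤ.* + (M * r ^ b) ≡ + (c * M * r ^ (a + b))
    leading = begin
        + c ℤ.* + (r ^ a) ℤ.* + (M * r ^ b)
      ≡⟨ cong (ℤ._* + (M * r ^ b)) (sym (pos-* c (r ^ a))) ⟩
        + (c * r ^ a) ℤ.* + (M * r ^ b)
      ≡⟨ sym (pos-* (c * r ^ a) (M * r ^ b)) ⟩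
        + (c * r ^ a * (M * r ^ b))
      ≡⟨ cong +_ (solve 4 (λ c x M y → c :* x :* (M :* y) := c :* M :* (x :* y)) refl c (r ^ a) M (r ^ b)) ⟩
        + (c * M * (r ^ a * r ^ b))
      ≡⟨ cong (λ z → + (c * M * z)) (sym (^-distribˡ-+-* r a b)) ⟩
        + (c * M * r ^ (a + b))
      ∎
      where open ≡-Reasoning

open import Defs
open import Data.Nat using (ℕ; _≥_; _*_; _^_; _/_; suc; NonZero)
open import Data.Nat.Base using (_!)
open import Data.Fin using (Fin)
open import Data.Integer using (ℤ; +_)
open import Relation.Binary.PropositionalEquality using (_≡_)
open import Relation.Binary.PropositionalEquality using (cong; sym; module ≡-Reasoning)
open Differences using (Σ<; Σ<-cong; sumTo≡Σ<; newtonSum; newton; Δ^)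
open Products using (multinomial; multinomial≡quotient; productSeq; A≡newtonTerm; ConstΔ-productSeq)

lemma1 : (m : ℕ) → m ≥ 1 → (r : ℕ) → (n : Fin m → ℕ) → ((j : Fin m) → n j ≥ 1) → (τ : Fin m → ℕ) →
    sumTo (sumℕ m n) (A m r n τ)
      ≡ + (_/_ ((sumℕ m n) ! * r ^ (sumℕ m n)) (prodℕ m (λ j → n j !)) {{prodFact≢0 m n}})
lemma1 m _ r n _ τ = begin
    sumTo N (A m r n τ)
  ≡⟨ sumTo≡Σ< N (A m r n τ) ⟩
    Σ< (suc N) (A m r n τ)
  ≡⟨ Σ<-cong (suc N) (A≡newtonTerm m r n τ) ⟩
    newtonSum (suc N) N (productSeq m r n τ) 0
  ≡⟨ newton N (productSeq m r n τ) 0 ⟩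
    Δ^ N (productSeq m r n τ) 0
  ≡⟨ ConstΔ-productSeq m r n τ 0 ⟩
    + (multinomial m n * r ^ N)
  ≡⟨ cong +_ (sym (multinomial≡quotient m n (r ^ N))) ⟩
    + (_/_ (N ! * r ^ N) (prodℕ m (λ j → n j !)) {{prodFact≢0 m n}})
  ∎
  where
  open ≡-Reasoning
  N = sumℕ m n
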